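{- Let $f:B\to A$ be a cover and $g:C\to A$ a Galois cover, and let $B\xleftarrow{p}U\xrightarrow{q}C$ be a pullback of $B\xrightarrow{f}A\xleftarrow{g}C$. Then $|{\rm Hom}(p\circ i,p\circ j)|=\deg(p\circ j)$ for all $i,j\in\Sigma(U)$. In particular: (i) for every $i\in\Sigma(U)$ the cover $p\circ i$ is Galois; (ii) the covers $p\circ i$, $i\in\Sigma(U)$, are pairwise isomorphic; (iii) $\deg(p\circ i)$ divides $\deg g$ for each $i\in\Sigma(U)$.
   Context: Let $\mathbf C$ be a category and $\mathbf D$ a full subcategory of $\mathbf C$. For arrows $f,g$ of $\mathbf C$ with ${\rm cod}\,f={\rm cod}\,g$, ${\rm Hom}(g,f)$ denotes the collection of all arrows $h$ of $\mathbf C$ with $g=f\circ h$. Standing assumptions: (G1) every diagram $B\to A\leftarrow C$ in $\mathbf D$ has a pullback in $\mathbf C$. (G2) (I) pushouts exist in $\mathbf D$; (II) every arrow of $\mathbf D$ is epic; (III) every monic arrow of $\mathbf D$ is an isomorphism whose inverse is an arrow of $\mathbf D$. (G3) for every object $U$ of $\mathbf C$ there is a set $\Sigma(U)$ of arrows $i$ of $\mathbf C$ with ${\rm dom}\,i$ in $\mathbf D$ and ${\rm cod}\,i=U$ such that for every arrow $u$ of $\mathbf C$ with ${\rm dom}\,u$ in $\mathbf D$ and ${\rm cod}\,u=U$ there is exactly one $i\in\Sigma(U)$ with ${\rm Hom}(u,i)\neq\emptyset$. (G4) there is a function $\deg$ from the collection of arrows of $\mathbf C$ whose codomain lies in $\mathbf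 D$ to the positive integers such that (I) $\deg(g\circ f)=\deg g\cdot\deg f$ whenever $f,g,g\circ f$ all lie in this collection; (II) $\deg f=\sum_{i\in\Sigma({\rm dom}\,f)}\deg(f\circ i)$ for every such $f$; (III) if $B\xrightarrow{f}A\xleftarrow{g}C$ is a diagram in $\mathbf D$ with pullback $B\xleftarrow{p}U\xrightarrow{q}C$, then $\deg f=\deg q$ and $\deg g=\deg p$. A cover is an arrow of $\mathbf D$. For a cover $f$, ${\rm Aut}(f)$ is the set of isomorphisms in ${\rm Hom}(f,f)$; $f$ is Galois if $|{\rm Aut}(f)|=\deg f$. Write $f\sqsubseteq g$ if ${\rm cod}\,f={\rm cod}\,g$ and ${\rm Hom}(g,f)\neq\emptyset$. Two covers $f,g$ are isomorphic if $f\sqsubseteq g$ and $g\sqsubseteq f$. -}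

module Defs where

open import Level using (Level; _⊔_) renaming (suc to lsuc)
open import Data.Nat using (ℕ; _+_; _*_; _>_)
import Data.Nat as ℕ
open import Data.Fin using (Fin; zero; suc)
open import Data.Product using (Σ; _×_; _,_)
open import Relation.Binary.PropositionalEquality using (_≡_)
open import Function.Definitions using (Bijective)

finSum : (n : ℕ) → (Fin n → ℕ) → ℕ
finSum ℕ.zero    f = 0
finSum (ℕ.suc n) f = f zero + finSum n (λ k → f (suc k))

HasCard : ∀ {a p} {X : Set a} → (X → Set p) → ℕ → Set (a ⊔ p)
HasCard {X = X} P n =
  Σ (Fin n → X) λ e →
    ((k : Fin n) → P (e k))
    × ((k k' : Fin n) → e k ≡ e k' → k ≡ k')
    × ((x : X) → P x → Σ (Fin n) λ k → e k ≡ x)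

-- A category (arrows compared by propositional equality).
record Category (o ℓ : Level) : Set (lsuc (o ⊔ ℓ)) where
  infixr 9 _∘_
  field
    Obj  : Set o
    Hom  : Obj → Obj → Set ℓ
    id   : ∀ {X} → Hom X X
    _∘_  : ∀ {X Y Z} → Hom Y Z → Hom X Y → Hom X Z
    identityˡ : ∀ {X Y} (f : Hom X Y) → id ∘ f ≡ f
    identityʳ : ∀ {X Y} (f : Hom X Y) → f ∘ id ≡ f
    assoc : ∀ {W X Y Z} (h : Hom Y Z) (g : Hom X Y) (f : Hom W X) →
            (h ∘ g) ∘ f ≡ h ∘ (g ∘ f)

module CatNotions {o ℓ} (𝐂 : Category o ℓ) where
  open Category 𝐂

  -- Hom(g,f) = { h | g = f ∘ h }  for cod g = cod f
  HomOver : ∀ {X Y Z} → Hom X Z → Hom Y Z → Hom X Y → Set ℓ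
  HomOver g f h = g ≡ f ∘ h

  HomNonempty : ∀ {X Y Z} → Hom X Z → Hom Y Z → Set ℓ
  HomNonempty {X} {Y} g f = Σ (Hom X Y) (HomOver g f)

  IsIso : ∀ {X Y} → Hom X Y → Set ℓ
  IsIso {X} {Y} h = Σ (Hom Y X) λ k → (k ∘ h ≡ id) × (h ∘ k ≡ id)

  IsPullback : ∀ {A B C U} → Hom B A → Hom C A → Hom U B → Hom U C → Set (o ⊔ ℓ)
  IsPullback {A} {B} {C} {U} f g p q =
    (f ∘ p ≡ g ∘ q) ×
    (∀ {W} (a : Hom W B) (b : Hom W C) → f ∘ a ≡ g ∘ b →
       Σ (Hom W U) λ h → ((p ∘ h ≡ a) × (q ∘ h ≡ b)) ×
         (∀ (h' : Hom W U) → (p ∘ h' ≡ a) × (q ∘ h' ≡ b) → h' ≡ h))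

-- The standing assumptions (G1)–(G4) on a category C with a full
-- subcategory D (given by the predicate inD on objects).
record GaloisSetting (o ℓ : Level) : Set (lsuc (o ⊔ ℓ)) where
  field
    𝐂 : Category o ℓ
  open Category 𝐂 public
  open CatNotions 𝐂 public
  field
    inD      : Obj → Set ℓ
    inD-prop : ∀ {X} (a b : inD X) → a ≡ b

    pullback : ∀ {A B C} → inD A → inD B → inD C →
               (f : Hom B A) (g : Hom C A) →
               Σ Obj λ U → Σ (Hom U B) λ p → Σ (Hom U C) λ q → IsPullback f g p q
    pushout : ∀ {A B C} → inD A → inD B → inD C →
              (f : Hom A B) (g : Hom A C) →
              Σ Obj λ P → inD P × (Σ (Hom B P) λ u → Σ (Hom C P) λ v →
                (u ∘ f ≡ v ∘ g) ×
                (∀ {W} → inD W → (a : Hom B W) (b : Hom C W) → a ∘ f ≡ b ∘ g →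
                   Σ (Hom P W) λ h → ((h ∘ u ≡ a) × (h ∘ v ≡ b)) ×
                     (∀ (h' : Hom P W) → (h' ∘ u ≡ a) × (h' ∘ v ≡ b) → h' ≡ h)))
    epic : ∀ {X Y} → inD X → inD Y → (f : Hom X Y) →
           ∀ {Z} → inD Z → (g h : Hom Y Z) → g ∘ f ≡ h ∘ f → g ≡ h
    -- (G2)(III) every monic arrow of D (monic in D) is an isomorphism
    -- (its inverse is automatically an arrow of D, D being full)
    monic⇒iso : ∀ {X Y} → inD X → inD Y → (f : Hom X Y) →
                (∀ {Z} → inD Z → (g h : Hom Z X) → f ∘ g ≡ f ∘ h → g ≡ h) →
                IsIso f

    -- (G3) the set Σ(U), as an indexed family of arrows into U
    Sig     : Obj → Set (o ⊔ ℓ)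
    sigDom  : ∀ {U} → Sig U → Obj
    sigInD  : ∀ {U} (i : Sig U) → inD (sigDom i)
    sigArr  : ∀ {U} (i : Sig U) → Hom (sigDom i) U
    sigUnique : ∀ {X U} → inD X → (u : Hom X U) →
                Σ (Sig U) λ i → HomNonempty u (sigArr i) ×
                  (∀ (j : Sig U) → HomNonempty u (sigArr j) → j ≡ i)

    deg     : ∀ {X A} → inD A → Hom X A → ℕ
    deg-pos : ∀ {X A} (dA : inD A) (f : Hom X A) → deg dA f > 0
    deg-∘   : ∀ {X Y A} (dY : inD Y) (dA : inD A) (g : Hom Y A) (f : Hom X Y) →
              deg dA (g ∘ f) ≡ deg dA g * deg dY f
    deg-Σ   : ∀ {U A} (dA : inD A) (f : Hom U A) →
              Σ ℕ λ n → Σ (Fin n → Sig U) λ e → Bijective _≡_ _≡_ e ×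
                (deg dA f ≡ finSum n (λ k → deg dA (f ∘ sigArr (e k))))
    deg-pb  : ∀ {A B C U} (dA : inD A) (dB : inD B) (dC : inD C)
              (f : Hom B A) (g : Hom C A) (p : Hom U B) (q : Hom U C) →
              IsPullback f g p q → (deg dA f ≡ deg dC q) × (deg dA g ≡ deg dB p)

  IsAut : ∀ {B A} → Hom B A → Hom B B → Set ℓ
  IsAut f h = HomOver f f h × IsIso h

  Galois : ∀ {B A} → inD A → inD B → Hom B A → Set ℓ
  Galois {B} dA dB f = HasCard (IsAut f) (deg dA f)

  IsoCovers : ∀ {X Y A} → Hom X A → Hom Y A → Set ℓ
  IsoCovers f g = HomNonempty g f × HomNonempty f g

-- The N = deg g automorphisms of g lift, via the pullback, to N automorphisms of U over B; composed
-- with a component i : X → U they give N distinct arrows over B, and each of them factors through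
-- exactly one component j, i.e. determines an element of Hom(p ∘ i, p ∘ j). Conversely an element of
-- Hom(a, b) is a section of the pullback of b along a, and sections of an arrow of D are determined
-- by the component through which they pass, so |Hom(a, b)| ≤ deg b. Since N = deg p = Σⱼ deg (p ∘ j),
-- all these inequalities are equalities.
module Submission where

open import Defs
open import Level using (_⊔_)
open import Data.Nat using (ℕ; zero; suc; _+_; _*_; _≤_; z≤n; s≤s)
open import Data.Nat.Base using (>-nonZero)
open import Data.Nat.Properties using (+-mono-≤; 1+n≰n; m≤m*n; ≤-antisym; ≤-trans; ≤-reflexive)
open import Data.Nat.Divisibility using (_∣_; divides)
open import Data.Fin using (Fin; zero; suc; _↑ˡ_; _↑ʳ_; splitAt; punchOut; inject≤)
open import Data.Fin.Properties
  using (splitAt-↑ˡ; splitAt-↑ʳ; any?; _≟_; punchOut-injective; injective⇒≤; inject≤-injective)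
open import Data.Product using (Σ; _×_; _,_; proj₁; proj₂; map₂)
open import Data.Sum using (inj₁; inj₂)
open import Function using (_∘′_; _$_)
open import Function.Bundles using (_↣_; mk↣; Injection)
open import Function.Definitions using (Injective; Surjective; StrictlySurjective)
open import Relation.Binary.PropositionalEquality
open import Relation.Nullary using (yes; no; contradiction)
open ≡-Reasoning

length≤finSum : ∀ n (w : Fin n → ℕ) → (∀ m → 1 ≤ w m) → n ≤ finSum n w
length≤finSum zero    w pos = z≤n
length≤finSum (suc n) w pos = +-mono-≤ (pos zero) (length≤finSum n (w ∘′ suc) (λ m → pos (suc m)))

finSum-const : ∀ n (w : Fin n → ℕ) {d} → (∀ m → w m ≡ d) → finSum n w ≡ n * d
finSum-const zero    w const = refl
finSum-const (suc n) w const = cong₂ _+_ (const zero) (finSum-const n (w ∘′ suc) (λ m → const (suc m)))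

Σ-join : ∀ n (w : Fin n → ℕ) → Σ (Fin n) (Fin ∘′ w) → Fin (finSum n w)
Σ-join (suc n) w (zero  , k) = k ↑ˡ finSum n (w ∘′ suc)
Σ-join (suc n) w (suc m , k) = w zero ↑ʳ Σ-join n (w ∘′ suc) (m , k)

Σ-split : ∀ n (w : Fin n → ℕ) → Fin (finSum n w) → Σ (Fin n) (Fin ∘′ w)
Σ-split (suc n) w i with splitAt (w zero) i
... | inj₁ k = zero , k
... | inj₂ j = let m , k = Σ-split n (w ∘′ suc) j in suc m , k

Σ-split-join : ∀ n (w : Fin n → ℕ) x → Σ-split n w (Σ-join n w x) ≡ x
Σ-split-join (suc n) w (zero , k) rewrite splitAt-↑ˡ (w zero) k (finSum n (w ∘′ suc)) = refl
Σ-split-join (suc n) w (suc m , k)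
  rewrite splitAt-↑ʳ (w zero) (finSum n (w ∘′ suc)) (Σ-join n (w ∘′ suc) (m , k))
        | Σ-split-join n (w ∘′ suc) (m , k) = refl

Σ-join-injective : ∀ n (w : Fin n → ℕ) → Injective _≡_ _≡_ (Σ-join n w)
Σ-join-injective n w {x} {y} eq =
  trans (sym (Σ-split-join n w x)) (trans (cong (Σ-split n w) eq) (Σ-split-join n w y))

injective⇒surjective : ∀ {n} (f : Fin n → Fin n) → Injective _≡_ _≡_ f → StrictlySurjective _≡_ f
injective⇒surjective {suc n} f f-inj y with any? (λ x → f x ≟ y)
... | yes hit = hit
... | no miss = contradiction (injective⇒≤ punched-injective) 1+n≰n
  where
  avoids : ∀ x → y ≢ f x
  avoids x y≡fx = miss (x , sym y≡fx)
  punched : Fin (suc n) → Fin n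
  punched x = punchOut (avoids x)
  punched-injective : Injective _≡_ _≡_ punched
  punched-injective eq = f-inj (punchOut-injective (avoids _) (avoids _) eq)

Σ-injective⇒surjective : ∀ {N n} (w : Fin n → ℕ) → N ≡ finSum n w →
  (c : Fin N → Σ (Fin n) (Fin ∘′ w)) → Injective _≡_ _≡_ c → StrictlySurjective _≡_ c
Σ-injective⇒surjective {n = n} w refl c c-inj y
  with x , jcx≡jy ← injective⇒surjective (Σ-join n w ∘′ c) (λ eq → c-inj (Σ-join-injective n w eq))
                                         (Σ-join n w y)
  = x , Σ-join-injective n w jcx≡jy

record AtMost {a p} {X : Set a} (P : X → Set p) (d : ℕ) : Set (a ⊔ p) where
  field
    index           : Σ X P → Fin d
    index-cong      : ∀ {s t} → proj₁ s ≡ proj₁ t → index s ≡ index t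
    index-injective : ∀ {s t} → index s ≡ index t → proj₁ s ≡ proj₁ t

module _ {a p} {X : Set a} {P : X → Set p} {d : ℕ} where

  AtMost⇒HasCard : (bound : AtMost P d) → StrictlySurjective _≡_ (AtMost.index bound) → HasCard P d
  AtMost⇒HasCard bound surj =
    proj₁ ∘′ element , (λ k → proj₂ (element k)) , element-injective , λ x Px → index (x , Px) , hits (x , Px)
    where
    open AtMost bound
    element : Fin d → Σ X P
    element k = proj₁ (surj k)
    element-injective : ∀ k k' → proj₁ (element k) ≡ proj₁ (element k') → k ≡ k'
    element-injective k k' eq = trans (sym (proj₂ (surj k))) (trans (index-cong eq) (proj₂ (surj k')))
    hits : ∀ s → proj₁ (element (index s)) ≡ proj₁ s
    hits s = index-injective (proj₂ (surj (index s)))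

  HasCard⇒inhabited : HasCard P d → 1 ≤ d → Σ X P
  HasCard⇒inhabited (e , Pe , _) (s≤s _) = e zero , Pe zero

  HasCard-injective⇒surjective : HasCard P d → (φ : X → X) → (∀ {x} → P x → P (φ x)) →
    (∀ {x y} → P x → P y → φ x ≡ φ y → x ≡ y) →
    ∀ {y} → P y → Σ X λ x → φ x ≡ y
  HasCard-injective⇒surjective (e , Pe , e-inj , e-surj) φ φ-P φ-inj {y} Py = e l , (begin
    φ (e l)          ≡⟨ sym (e∘conjugate l) ⟩
    e (conjugate l)  ≡⟨ cong e conjugate-l≡k ⟩
    e k              ≡⟨ proj₂ (e-surj y Py) ⟩
    y                ∎)
    where
    conjugate : Fin d → Fin d
    conjugate l = proj₁ (e-surj (φ (e l)) (φ-P (Pe l)))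
    e∘conjugate : ∀ l → e (conjugate l) ≡ φ (e l)
    e∘conjugate l = proj₂ (e-surj (φ (e l)) (φ-P (Pe l)))
    conjugate-injective : Injective _≡_ _≡_ conjugate
    conjugate-injective {l} {l'} eq = e-inj l l' (φ-inj (Pe l) (Pe l')
      (trans (sym (e∘conjugate l)) (trans (cong e eq) (e∘conjugate l'))))
    k : Fin d
    k = proj₁ (e-surj y Py)
    l : Fin d
    l = proj₁ (injective⇒surjective conjugate conjugate-injective k)
    conjugate-l≡k : conjugate l ≡ k
    conjugate-l≡k = proj₂ (injective⇒surjective conjugate conjugate-injective k)

module Enumeration {a} {A : Set a} {n} (e : Fin n → A) (e-surjective : Surjective _≡_ _≡_ e) where

  index : A → Fin n
  index x = proj₁ (e-surjective x)

  e∘index : ∀ x → e (index x) ≡ x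
  e∘index x = proj₂ (e-surjective x) refl

  index-injective : Injective _≡_ _≡_ index
  index-injective {x} {y} eq = trans (sym (e∘index x)) (trans (cong e eq) (e∘index y))

module Setting {o ℓ} (S : GaloisSetting o ℓ) where
  open GaloisSetting S

  leftInverse⇒monic : ∀ {X Y} {r : Hom Y X} {t : Hom X Y} → r ∘ t ≡ id →
    ∀ {Z} {g h : Hom Z X} → t ∘ g ≡ t ∘ h → g ≡ h
  leftInverse⇒monic {r = r} {t} rt {g = g} {h} tg≡th = begin
    g            ≡⟨ sym (identityˡ g) ⟩
    id ∘ g       ≡⟨ cong (_∘ g) (sym rt) ⟩
    (r ∘ t) ∘ g  ≡⟨ assoc r t g ⟩
    r ∘ (t ∘ g)  ≡⟨ cong (r ∘_) tg≡th ⟩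
    r ∘ (t ∘ h)  ≡⟨ sym (assoc r t h) ⟩
    (r ∘ t) ∘ h  ≡⟨ cong (_∘ h) rt ⟩
    id ∘ h       ≡⟨ identityˡ h ⟩
    h            ∎

  leftInverse≡rightInverse : ∀ {X Y} {r u : Hom Y X} {t : Hom X Y} → r ∘ t ≡ id → t ∘ u ≡ id → r ≡ u
  leftInverse≡rightInverse {r = r} {u} {t} rt tu = begin
    r            ≡⟨ sym (identityʳ r) ⟩
    r ∘ id       ≡⟨ cong (r ∘_) (sym tu) ⟩
    r ∘ (t ∘ u)  ≡⟨ sym (assoc r t u) ⟩
    (r ∘ t) ∘ u  ≡⟨ cong (_∘ u) rt ⟩
    id ∘ u       ≡⟨ identityˡ u ⟩
    u            ∎

  -- A section of r is monic, hence by (G2)(III) an isomorphism, necessarily inverse to r.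
  section-unique : ∀ {X Y} → inD X → inD Y → {r : Hom Y X} {t t' : Hom X Y} →
    r ∘ t ≡ id → r ∘ t' ≡ id → t ≡ t'
  section-unique dX dY {r} {t} {t'} rt rt' with monic⇒iso dX dY t (λ _ _ _ → leftInverse⇒monic rt)
  ... | u , _ , tu = sym $ begin
    t'            ≡⟨ sym (identityˡ t') ⟩
    id ∘ t'       ≡⟨ cong (_∘ t') (sym tu) ⟩
    (t ∘ u) ∘ t'  ≡⟨ assoc t u t' ⟩
    t ∘ (u ∘ t')  ≡⟨ cong (λ v → t ∘ (v ∘ t')) (sym (leftInverse≡rightInverse rt tu)) ⟩
    t ∘ (r ∘ t')  ≡⟨ cong (t ∘_) rt' ⟩
    t ∘ id        ≡⟨ identityʳ t ⟩
    t             ∎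

  Sig↣deg : ∀ {U A} (dA : inD A) (f : Hom U A) → Sig U ↣ Fin (deg dA f)
  Sig↣deg dA f with deg-Σ dA f
  ... | n , e , (_ , e-surjective) , deg≡ =
    mk↣ {to = λ c → inject≤ (index c) n≤deg}
        (λ eq → index-injective (inject≤-injective n≤deg n≤deg _ _ eq))
    where
    open Enumeration e e-surjective
    n≤deg : n ≤ deg dA f
    n≤deg = subst (n ≤_) (sym deg≡) (length≤finSum n _ (λ m → deg-pos dA _))

  module _ {A B C U} {f : Hom B A} {g : Hom C A} {p : Hom U B} {q : Hom U C}
           (pb : IsPullback f g p q) where

    pullback-jointly-monic : ∀ {W} {s s' : Hom W U} → p ∘ s ≡ p ∘ s' → q ∘ s ≡ q ∘ s' → s ≡ s'
    pullback-jointly-monic {s = s} {s'} ps≡ps' qs≡qs' =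
      trans (unique s (ps≡ps' , qs≡qs')) (sym (unique s' (refl , refl)))
      where
      commutes : f ∘ (p ∘ s') ≡ g ∘ (q ∘ s')
      commutes = trans (sym (assoc f p s')) (trans (cong (_∘ s') (proj₁ pb)) (assoc g q s'))
      unique : ∀ h → (p ∘ h ≡ p ∘ s') × (q ∘ h ≡ q ∘ s') →
               h ≡ proj₁ (proj₂ pb (p ∘ s') (q ∘ s') commutes)
      unique = proj₂ (proj₂ (proj₂ pb (p ∘ s') (q ∘ s') commutes))

    pullback-section : ∀ {k : Hom B C} → HomOver f g k → Σ (Hom B U) λ s → (p ∘ s ≡ id) × (q ∘ s ≡ k)
    pullback-section {k} f≡gk = map₂ proj₁ (proj₂ pb id k (trans (identityʳ f) f≡gk))

    pullback-endo : ∀ {h : Hom C C} → HomOver g g h → Σ (Hom U U) λ s → (p ∘ s ≡ p) × (q ∘ s ≡ h ∘ q)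
    pullback-endo {h} g≡gh = map₂ proj₁ (proj₂ pb p (h ∘ q) commutes)
      where
      commutes : f ∘ p ≡ g ∘ (h ∘ q)
      commutes = trans (proj₁ pb) (trans (cong (_∘ q) g≡gh) (assoc g h q))

  component : ∀ {X U} → inD X → Hom X U → Sig U
  component dX u = proj₁ (sigUnique dX u)

  component-factors : ∀ {X U} (dX : inD X) (u : Hom X U) → HomNonempty u (sigArr (component dX u))
  component-factors dX u = proj₁ (proj₂ (sigUnique dX u))

  sections-through-component-unique : ∀ {X V} → inD X → {r : Hom V X} (c : Sig V) {s s' : Hom X V} →
    HomNonempty s (sigArr c) → HomNonempty s' (sigArr c) → r ∘ s ≡ id → r ∘ s' ≡ id → s ≡ s'
  sections-through-component-unique dX {r} c {s} {s'} (t , s≡ct) (t' , s'≡ct') rs rs' = begin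
    s             ≡⟨ s≡ct ⟩
    sigArr c ∘ t  ≡⟨ cong (sigArr c ∘_) t≡t' ⟩
    sigArr c ∘ t' ≡⟨ sym s'≡ct' ⟩
    s'            ∎
    where
    retracts : ∀ {s t} → s ≡ sigArr c ∘ t → r ∘ s ≡ id → (r ∘ sigArr c) ∘ t ≡ id
    retracts {s} {t} s≡ct rs = trans (assoc r (sigArr c) t) (trans (cong (r ∘_) (sym s≡ct)) rs)
    t≡t' : t ≡ t'
    t≡t' = section-unique dX (sigInD c) (retracts s≡ct rs) (retracts s'≡ct' rs')

  sections-unique-by-component : ∀ {X V} (dX : inD X) {r : Hom V X} {s s' : Hom X V} →
    r ∘ s ≡ id → r ∘ s' ≡ id → component dX s ≡ component dX s' → s ≡ s'
  sections-unique-by-component dX {s = s} {s'} rs rs' same =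
    sections-through-component-unique dX (component dX s')
      (subst (λ c → HomNonempty s (sigArr c)) same (component-factors dX s)) (component-factors dX s') rs rs'

  module _ {X Y B V} (dX : inD X) {a : Hom X B} {b : Hom Y B} {p' : Hom V X} {q' : Hom V Y}
           (pb : IsPullback a b p' q') where

    private
      section : ∀ {k} → HomOver a b k → Hom X V
      section a≡bk = proj₁ (pullback-section pb a≡bk)

      p'∘section : ∀ {k} (a≡bk : HomOver a b k) → p' ∘ section a≡bk ≡ id
      p'∘section a≡bk = proj₁ (proj₂ (pullback-section pb a≡bk))

      q'∘section : ∀ {k} (a≡bk : HomOver a b k) → q' ∘ section a≡bk ≡ k
      q'∘section a≡bk = proj₂ (proj₂ (pullback-section pb a≡bk))

      sectionIndex : Σ (Hom X Y) (HomOver a b) → Fin (deg dX p')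
      sectionIndex (_ , a≡bk) = Injection.to (Sig↣deg dX p') (component dX (section a≡bk))

    -- Arrows over B from a to b are sections of p', and those are told apart by their components.
    HomOver-atMost-pullback : AtMost (HomOver a b) (deg dX p')
    HomOver-atMost-pullback = record
      { index = sectionIndex ; index-cong = index-cong ; index-injective = index-injective }
      where
      index-cong : ∀ {s t} → proj₁ s ≡ proj₁ t → sectionIndex s ≡ sectionIndex t
      index-cong {_ , a≡bk} {_ , a≡bk'} refl =
        cong (λ s → Injection.to (Sig↣deg dX p') (component dX s))
          (pullback-jointly-monic pb (trans (p'∘section a≡bk) (sym (p'∘section a≡bk')))
                                     (trans (q'∘section a≡bk) (sym (q'∘section a≡bk'))))
      index-injective : ∀ {s t} → sectionIndex s ≡ sectionIndex t → proj₁ s ≡ proj₁ t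
      index-injective {k , a≡bk} {k' , a≡bk'} eq = begin
        k                    ≡⟨ sym (q'∘section a≡bk) ⟩
        q' ∘ section a≡bk    ≡⟨ cong (q' ∘_) same-section ⟩
        q' ∘ section a≡bk'   ≡⟨ q'∘section a≡bk' ⟩
        k'                   ∎
        where
        same-section : section a≡bk ≡ section a≡bk'
        same-section = sections-unique-by-component dX (p'∘section a≡bk) (p'∘section a≡bk')
          (Injection.injective (Sig↣deg dX p') eq)

  -- Opaque because only its statement is needed: unfolding it makes the conversion checks in
  -- Counting blow up.
  opaque
    HomOver-atMost : ∀ {X Y B} (dX : inD X) (dY : inD Y) (dB : inD B) (a : Hom X B) (b : Hom Y B) →
      AtMost (HomOver a b) (deg dB b)
    HomOver-atMost dX dY dB a b with pullback dB dX dY a b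
    ... | _ , p' , q' , pb =
      subst (AtMost (HomOver a b)) (sym (proj₂ (deg-pb dB dX dY a b p' q' pb))) (HomOver-atMost-pullback dX pb)

  -- Precomposition with h is injective on the finite collection Hom(a,a), since h is epic,
  -- hence surjective; a preimage of id is a left inverse of h.
  HomOver-card⇒iso : ∀ {X B} (dX : inD X) {a : Hom X B} {d} → HasCard (HomOver a a) d →
    ∀ {h} → HomOver a a h → IsIso h
  HomOver-card⇒iso dX {a} card {h} a≡ah =
    monic⇒iso dX dX h (λ _ _ _ → leftInverse⇒monic (proj₂ left-inverse))
    where
    over : ∀ {x} → HomOver a a x → HomOver a a (x ∘ h)
    over {x} a≡ax = trans a≡ah (trans (cong (_∘ h) a≡ax) (assoc a x h))
    over-injective : ∀ {x y} → HomOver a a x → HomOver a a y → x ∘ h ≡ y ∘ h → x ≡ y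
    over-injective _ _ = epic dX dX h dX _ _
    left-inverse : Σ (Hom _ _) λ l → l ∘ h ≡ id
    left-inverse = HasCard-injective⇒surjective card (_∘ h) over over-injective (sym (identityʳ a))

  HomOver-card⇒Galois : ∀ {X B} (dX : inD X) (dB : inD B) {a : Hom X B} →
    HasCard (HomOver a a) (deg dB a) → Galois dB dX a
  HomOver-card⇒Galois dX dB card@(e , over , e-injective , e-surjective) =
    e , (λ k → over k , HomOver-card⇒iso dX card (over k)) , e-injective , λ h aut → e-surjective h (proj₁ aut)

  deg-≤-factor : ∀ {X Y B} (dY : inD Y) (dB : inD B) {a : Hom X B} {b : Hom Y B} →
    HomNonempty a b → deg dB b ≤ deg dB a
  deg-≤-factor dY dB {a} {b} (h , a≡bh) =
    ≤-trans (m≤m*n (deg dB b) (deg dY h) {{>-nonZero (deg-pos dY h)}}) (≤-reflexive (sym deg-a))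
    where
    deg-a : deg dB a ≡ deg dB b * deg dY h
    deg-a = trans (cong (deg dB) a≡bh) (deg-∘ dY dB b h)

  equal-component-degrees⇒∣ : ∀ {U A} (dA : inD A) (f : Hom U A) →
    (∀ i j → deg dA (f ∘ sigArr i) ≡ deg dA (f ∘ sigArr j)) → ∀ i → deg dA (f ∘ sigArr i) ∣ deg dA f
  equal-component-degrees⇒∣ dA f equal i with deg-Σ dA f
  ... | n , e , _ , deg≡ = divides n (trans deg≡ (finSum-const n _ (λ m → equal (e m) i)))

  module GaloisPullback {A B C U} (dA : inD A) (dB : inD B) (dC : inD C) {f : Hom B A} {g : Hom C A}
    (galois : Galois dA dC g) {p : Hom U B} {q : Hom U C} (pb : IsPullback f g p q) where

    private
      G : Fin (deg dA g) → Hom C C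
      G = proj₁ galois

      G-over : ∀ r → HomOver g g (G r)
      G-over r = proj₁ (proj₁ (proj₂ galois) r)

      G-injective : Injective _≡_ _≡_ G
      G-injective = proj₁ (proj₂ (proj₂ galois)) _ _

    deck : Fin (deg dA g) → Hom U U
    deck r = proj₁ (pullback-endo pb (G-over r))

    p∘deck : ∀ r → p ∘ deck r ≡ p
    p∘deck r = proj₁ (proj₂ (pullback-endo pb (G-over r)))

    q∘deck : ∀ r → q ∘ deck r ≡ G r ∘ q
    q∘deck r = proj₂ (proj₂ (pullback-endo pb (G-over r)))

    module _ (i : Sig U) where

      lift : Fin (deg dA g) → Hom (sigDom i) U
      lift r = deck r ∘ sigArr i

      p∘lift : ∀ r → p ∘ lift r ≡ p ∘ sigArr i
      p∘lift r = trans (sym (assoc p (deck r) (sigArr i))) (cong (_∘ sigArr i) (p∘deck r))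

      q∘lift : ∀ r → q ∘ lift r ≡ G r ∘ (q ∘ sigArr i)
      q∘lift r = trans (sym (assoc q (deck r) (sigArr i)))
                       (trans (cong (_∘ sigArr i) (q∘deck r)) (assoc (G r) q (sigArr i)))

      lift-injective : Injective _≡_ _≡_ lift
      lift-injective {r} {r'} eq = G-injective
        (epic (sigInD i) dC (q ∘ sigArr i) dC (G r) (G r')
          (trans (sym (q∘lift r)) (trans (cong (q ∘_) eq) (q∘lift r'))))

    module Counting (i : Sig U) {n} (e : Fin n → Sig U) (e-surjective : Surjective _≡_ _≡_ e)
      (deg-g≡ : deg dA g ≡ finSum n (λ m → deg dB (p ∘ sigArr (e m)))) where

      open Enumeration e e-surjective

      private
        a : Hom (sigDom i) B
        a = p ∘ sigArr i

        w : Fin n → ℕ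
        w m = deg dB (p ∘ sigArr (e m))

        Factorization : Fin n → Set ℓ
        Factorization m = Σ (Hom (sigDom i) (sigDom (e m))) (HomOver a (p ∘ sigArr (e m)))

        bound : ∀ m → AtMost (HomOver a (p ∘ sigArr (e m))) (w m)
        bound m = HomOver-atMost (sigInD i) (sigInD (e m)) dB a (p ∘ sigArr (e m))

        factors-through-enumerated : ∀ {X} (dX : inD X) (u : Hom X U) →
          Σ (Fin n) λ m → HomNonempty u (sigArr (e m))
        factors-through-enumerated dX u =
          index c , subst (λ c → HomNonempty u (sigArr c)) (sym (e∘index c)) (component-factors dX u)
          where
          c : Sig U
          c = component dX u

        factor : (r : Fin (deg dA g)) →
          Σ (Fin n) λ m → Σ (Factorization m) λ x → lift i r ≡ sigArr (e m) ∘ proj₁ x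
        factor r with factors-through-enumerated (sigInD i) (lift i r)
        ... | m , h , lift≡eh = m , (h , over) , lift≡eh
          where
          over : HomOver a (p ∘ sigArr (e m)) h
          over = begin
            a                      ≡⟨ sym (p∘lift i r) ⟩
            p ∘ lift i r           ≡⟨ cong (p ∘_) lift≡eh ⟩
            p ∘ (sigArr (e m) ∘ h) ≡⟨ sym (assoc p (sigArr (e m)) h) ⟩
            (p ∘ sigArr (e m)) ∘ h ∎

        code : Fin (deg dA g) → Σ (Fin n) (λ m → Fin (w m))
        code r = proj₁ (factor r) , AtMost.index (bound _) (proj₁ (proj₂ (factor r)))

        same-code⇒same-arrow : ∀ {m m'} (x : Factorization m) (x' : Factorization m') {k k'} →
          AtMost.index (bound m) x ≡ k → AtMost.index (bound m') x' ≡ k' →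
          _≡_ {A = Σ (Fin n) (λ m → Fin (w m))} (m , k) (m' , k') →
          sigArr (e m) ∘ proj₁ x ≡ sigArr (e m') ∘ proj₁ x'
        same-code⇒same-arrow x x' x↦k x'↦k refl =
          cong (sigArr (e _) ∘_) (AtMost.index-injective (bound _) (trans x↦k (sym x'↦k)))

        code-injective : Injective _≡_ _≡_ code
        code-injective {r} {r'} eq = lift-injective i $ begin
          lift i r                                       ≡⟨ proj₂ (proj₂ (factor r)) ⟩
          sigArr (e _) ∘ proj₁ (proj₁ (proj₂ (factor r)))  ≡⟨ same-code⇒same-arrow _ _ refl refl eq ⟩
          sigArr (e _) ∘ proj₁ (proj₁ (proj₂ (factor r'))) ≡⟨ sym (proj₂ (proj₂ (factor r'))) ⟩
          lift i r'                                      ∎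

        preimage : ∀ {m m'} (x : Factorization m') {k} → (m' , AtMost.index (bound m') x) ≡ (m , k) →
          Σ (Factorization m) λ y → AtMost.index (bound m) y ≡ k
        preimage x refl = x , refl

        index-surjective : ∀ m → StrictlySurjective _≡_ (AtMost.index (bound m))
        index-surjective m k with r , code-r≡ ← Σ-injective⇒surjective w deg-g≡ code code-injective (m , k)
          = preimage (proj₁ (proj₂ (factor r))) code-r≡

      card : ∀ j → HasCard (HomOver a (p ∘ sigArr j)) (deg dB (p ∘ sigArr j))
      card j = subst (λ j → HasCard (HomOver a (p ∘ sigArr j)) (deg dB (p ∘ sigArr j))) (e∘index j)
        (AtMost⇒HasCard (bound (index j)) (index-surjective (index j)))

    HomOver-card : ∀ i j → HasCard (HomOver (p ∘ sigArr i) (p ∘ sigArr j)) (deg dB (p ∘ sigArr j))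
    HomOver-card i with deg-Σ dB p
    ... | _ , e , (_ , e-surjective) , deg-p≡ =
      Counting.card i e e-surjective (trans (proj₂ (deg-pb dA dB dC f g p q pb)) deg-p≡)

lemma4p14 : ∀ {o ℓ} (S : GaloisSetting o ℓ) → let open GaloisSetting S in
    ∀ {A B C U} (dA : inD A) (dB : inD B) (dC : inD C)
      (f : Hom B A) (g : Hom C A) → Galois dA dC g →
      (p : Hom U B) (q : Hom U C) → IsPullback f g p q →
      ((i j : Sig U) → HasCard (HomOver (p ∘ sigArr i) (p ∘ sigArr j)) (deg dB (p ∘ sigArr j)))
      × ((i : Sig U) → Galois dB (sigInD i) (p ∘ sigArr i))
      × ((i j : Sig U) → IsoCovers (p ∘ sigArr i) (p ∘ sigArr j))
      × ((i : Sig U) → deg dB (p ∘ sigArr i) ∣ deg dA g)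
lemma4p14 S dA dB dC f g galois p q pb =
  HomOver-card , (λ i → HomOver-card⇒Galois (sigInD i) dB (HomOver-card i i)) , isomorphic , deg-∣
  where
  open GaloisSetting S
  open Setting S
  open GaloisPullback dA dB dC galois pb

  isomorphic : ∀ i j → IsoCovers (p ∘ sigArr i) (p ∘ sigArr j)
  isomorphic i j = HasCard⇒inhabited (HomOver-card j i) (deg-pos dB _)
                 , HasCard⇒inhabited (HomOver-card i j) (deg-pos dB _)

  equal-degrees : ∀ i j → deg dB (p ∘ sigArr i) ≡ deg dB (p ∘ sigArr j)
  equal-degrees i j = ≤-antisym (deg-≤-factor (sigInD i) dB (proj₁ (isomorphic i j)))
                                (deg-≤-factor (sigInD j) dB (proj₂ (isomorphic i j)))

  deg-∣ : ∀ i → deg dB (p ∘ sigArr i) ∣ deg dA g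
  deg-∣ i = subst (deg dB (p ∘ sigArr i) ∣_) (sym (proj₂ (deg-pb dA dB dC f g p q pb)))
                  (equal-component-degrees⇒∣ dB p equal-degrees i)
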